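{- Let $N\ge 1$ be an integer. For every integer $n\ge 1$, $$ CC_{N,n}=\Pi(n)\sum_{k=1}^{n}\binom{n+1}{k+1}(-L_N)^k\sum_{\substack{i_1,\dots,i_k\ge 0\\ r^{N+i_1}+\cdots+r^{N+i_k}=n+k r^N}}\frac{(-1)^{i_1+\cdots+i_k}}{L_{N+i_1}\cdots L_{N+i_k}}\,. $$
   Context: Let $r$ be a power of a prime, $T$ an indeterminate and $K=\mathbb F_r(T)$. For $i\ge 1$ put $[i]=T^{r^i}-T$, $D_i=[i][i-1]^r\cdots[1]^{r^{i-1}}$ and $L_i=[i][i-1]\cdots[1]$, with $D_0=L_0=1$. The Carlitz logarithm is the formal power series $\log_C(x)=\sum_{i=0}^\infty(-1)^i x^{r^i}/L_i\in K[[x]]$. For a non-negative integer $i$ with base-$r$ expansion $i=\sum_{j=0}^m c_j r^j$ ($0\le c_j<r$), the Carlitz factorial is $\Pi(i)=\prod_{j=0}^m D_j^{c_j}$. For $N\ge 1$, the truncated Cauchy-Carlitz numbers $CC_{N,n}\in K$ are defined by the formal power series identity $$ \frac{(-1)^N x^{r^N}/L_N}{\log_C(x)-\sum_{i=0}^{N-1}(-1)^i x^{r^i}/L_i}=\sum_{n=0}^\infty\frac{CC_{N,n}}{\Pi(n)}x^n . $$ The binomial coefficient $\binom{n+1}{k+1}$ is the ordinary integer, viewed in $K$. -}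

module Defs where

open import Level using (Level; _⊔_) renaming (suc to lsuc)
open import Algebra.Bundles using (CommutativeRing)
open import Data.Nat using (ℕ; zero; suc)
import Data.Nat as Nat
open import Data.Nat.Primality using (Prime)
open import Data.Nat.Combinatorics using (_C_)
open import Data.Fin using (Fin)
open import Data.List using (List; []; _∷_; foldr; map; upTo; concatMap)
open import Data.List.Relation.Unary.All using (All)
open import Data.Vec as Vec using (Vec)
open import Data.Product using (Σ; ∃; ∃₂; _×_)
open import Relation.Nullary using (¬_; Dec; yes; no)
open import Relation.Binary.PropositionalEquality using (_≡_)

IsPrimePower : ℕ → Set
IsPrimePower r = ∃₂ λ p e → Prime p × r ≡ p Nat.^ suc e

-- A field: a commutative ring with 1 ≉ 0 and a (total) inverse map which is
-- a two-sided inverse on non-zero elements (the value of 0⁻¹ is irrelevant).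
record Field (c ℓ : Level) : Set (lsuc (c ⊔ ℓ)) where
  field
    commutativeRing : CommutativeRing c ℓ
  open CommutativeRing commutativeRing public
  infix 8 _⁻¹
  field
    _⁻¹        : Carrier → Carrier
    1≉0        : ¬ (1# ≈ 0#)
    ⁻¹-inverse : ∀ x → ¬ (x ≈ 0#) → x * (x ⁻¹) ≈ 1#

module FieldOps {c ℓ : Level} (K : Field c ℓ) where
  open Field K

  infixl 7 _÷_
  _÷_ : Carrier → Carrier → Carrier
  x ÷ y = x * (y ⁻¹)

  infixr 8 _^ᴷ_
  _^ᴷ_ : Carrier → ℕ → Carrier
  x ^ᴷ zero  = 1#
  x ^ᴷ suc n = x * (x ^ᴷ n)

  fromℕ : ℕ → Carrier
  fromℕ zero    = 0#
  fromℕ (suc n) = 1# + fromℕ n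

  sumL : List Carrier → Carrier
  sumL = foldr _+_ 0#

  prodL : List Carrier → Carrier
  prodL = foldr _*_ 1#

  ∑< : ℕ → (ℕ → Carrier) → Carrier
  ∑< n f = sumL (map f (upTo n))

  when : {p : Level} {P : Set p} → Dec P → Carrier → Carrier
  when (yes _) x = x
  when (no _)  _ = 0#

  -- polynomial with coefficient list a₀ ∷ a₁ ∷ ... evaluated at x (Horner)
  evalPoly : List Carrier → Carrier → Carrier
  evalPoly as x = foldr (λ a acc → a + x * acc) 0# as

-- K is (a copy of) the rational function field F_r(T):
-- emb identifies Fin r with a subfield F ⊆ K of r elements,
-- T is transcendental over F, and K = F(T) (every element is p(T)/q(T)).
record IsRationalFunctionField {c ℓ : Level} (K : Field c ℓ) (r : ℕ)
                               (T : Field.Carrier K) : Set (c ⊔ ℓ) where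
  open Field K
  open FieldOps K
  field
    emb           : Fin r → Carrier
    emb-injective : ∀ a b → emb a ≈ emb b → a ≡ b
    emb-0         : ∃ λ a → emb a ≈ 0#
    emb-1         : ∃ λ a → emb a ≈ 1#
    emb-+         : ∀ a b → ∃ λ d → emb d ≈ emb a + emb b
    emb-*         : ∀ a b → ∃ λ d → emb d ≈ emb a * emb b
    emb-neg       : ∀ a → ∃ λ d → emb d ≈ - emb a
    emb-inv       : ∀ a → ∃ λ d → emb d ≈ emb a ⁻¹
    transcendental : ∀ (cs : List (Fin r)) →
                     evalPoly (map emb cs) T ≈ 0# → All (λ a → emb a ≈ 0#) cs
    generated     : ∀ x → ∃₂ λ (ps qs : List (Fin r)) →
                    ¬ (evalPoly (map emb qs) T ≈ 0#) ×
                    x ≈ evalPoly (map emb ps) T ÷ evalPoly (map emb qs) T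

module Carlitz {c ℓ : Level} (K : Field c ℓ) (r : ℕ) (T : Field.Carrier K) where
  open Field K
  open FieldOps K

  bracket : ℕ → Carrier
  bracket i = T ^ᴷ (r Nat.^ i) - T

  L : ℕ → Carrier
  L zero    = 1#
  L (suc i) = bracket (suc i) * L i

  D : ℕ → Carrier
  D zero    = 1#
  D (suc i) = bracket (suc i) * (D i ^ᴷ r)

  -- Π-aux s fuel j n = ∏_t D_(j+t)^(digit_t of n in base s), reading at most
  -- `fuel` digits.  Only meaningful for s ≥ 2 (which holds as r is a prime power).
  Π-aux : ℕ → ℕ → ℕ → ℕ → Carrier
  Π-aux (suc (suc s)) (suc f) j n =
    (D j ^ᴷ (n Nat.% suc (suc s))) * Π-aux (suc (suc s)) f (suc j) (n Nat./ suc (suc s))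
  Π-aux _ _ _ _ = 1#

  -- Carlitz factorial Π(n) = ∏_j D_j^(c_j), n = Σ c_j r^j; n + 1 digits suffice
  -- since n < 2^(n+1) ≤ r^(n+1).
  Π : ℕ → Carrier
  Π n = Π-aux r (suc n) 0 n

  sign : ℕ → Carrier
  sign m = (- 1#) ^ᴷ m

  -- coefficient of x^m in log_C(x) = Σ_i (-1)^i x^(r^i) / L_i
  -- (any i with r^i = m satisfies i ≤ m)
  logCoeff : ℕ → Carrier
  logCoeff m = ∑< (suc m) (λ i → when (r Nat.^ i Nat.≟ m) (sign i ÷ L i))

  truncCoeff : ℕ → ℕ → Carrier
  truncCoeff N m = ∑< N (λ i → when (r Nat.^ i Nat.≟ m) (sign i ÷ L i))

  denCoeff : ℕ → ℕ → Carrier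
  denCoeff N m = logCoeff m - truncCoeff N m

  numCoeff : ℕ → ℕ → Carrier
  numCoeff N m = when (r Nat.^ N Nat.≟ m) (sign N ÷ L N)

  seriesMul : (ℕ → Carrier) → (ℕ → Carrier) → ℕ → Carrier
  seriesMul f g m = ∑< (suc m) (λ j → f j * g (m Nat.∸ j))

  -- cc is the sequence of truncated Cauchy-Carlitz numbers CC_{N,n}:
  -- numerator / denominator = Σ_n cc n / Π(n) x^n  in K[[x]],
  -- i.e. denominator * (Σ_n cc n / Π(n) x^n) = numerator.
  IsTruncCauchyCarlitz : ℕ → (ℕ → Carrier) → Set ℓ
  IsTruncCauchyCarlitz N cc =
    ∀ m → seriesMul (denCoeff N) (λ n → cc n ÷ Π n) m ≈ numCoeff N m

  tuples : ℕ → (k : ℕ) → List (Vec ℕ k)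
  tuples b zero    = Vec.[] ∷ []
  tuples b (suc k) = concatMap (λ i → map (i Vec.∷_) (tuples b k)) (upTo b)

  -- Every such tuple has all i_j ≤ n, so ranging over {0..n}^k is exhaustive.
  innerSum : ℕ → ℕ → (k : ℕ) → Carrier
  innerSum N n k =
    sumL (map (λ v → when (Vec.sum (Vec.map (λ i → r Nat.^ (N Nat.+ i)) v) Nat.≟ n Nat.+ k Nat.* r Nat.^ N)
                          (sign (Vec.sum v) ÷ prodL (Vec.toList (Vec.map (λ i → L (N Nat.+ i)) v))))
              (tuples (suc n) k))

  rhs : ℕ → ℕ → Carrier
  rhs N n = Π n * ∑< n (λ j → let k = suc j in
              fromℕ (suc n C suc k) * ((- L N) ^ᴷ k) * innerSum N n k)

{-# OPTIONS --safe #-}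
-- Let D(x) = log_C(x) - Σ_{i<N} (-1)^i x^(r^i)/L_i, whose lowest term is (-1)^N x^(r^N)/L_N, and put
-- g(x) = -(-1)^N L_N D(x)/x^(r^N) = -1 + Σ_{i≥1} (-L_N)(-1)^i x^(r^(N+i) - r^N)/L_(N+i).
-- The defining identity of CC_{N,n} says that a(x) = Σ_n CC_{N,n} x^n/Π(n) satisfies g·a = -1.
-- As 1 + g has no constant term, (1 + g)^(n+1) = 1 + g·Σ_{k≤n} C(n+1,k+1) g^k is O(x^(n+1)),
-- so a agrees with Σ_{k≤n} C(n+1,k+1) g^k up to x^n; expanding the powers g^k coefficientwise
-- gives the sum over (i_1,…,i_k).  Π(n) ≠ 0 because each [i] ≠ 0, T being transcendental.
module Submission where

open import Defs
open import Level using (Level)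
open import Algebra.Bundles using (Semiring; CommutativeRing)
open import Data.Nat as ℕ using (ℕ; zero; suc; _≤_; _<_; z≤n; s≤s; _∸_; _≟_)
open import Data.Nat.Properties as ℕP using (m∸n≤m; n<1+n; m<n⇒m<1+n)
open import Data.Nat.Combinatorics using (_C_; nCk+nC[k+1]≡[n+1]C[k+1])
open import Data.Nat.Induction using (<-rec)
open import Data.List as List using (List; []; _∷_; _++_)
open import Data.Fin using (Fin)
import Data.List.Properties as Listₚ
open import Data.Empty using (⊥-elim)
open import Data.Sum using (inj₁; inj₂)
open import Data.Product using (_,_; proj₁; proj₂)
open import Function using (_∘_; id)
open import Relation.Nullary using (¬_; Dec; yes; no)
open import Relation.Unary using (Decidable)
open import Relation.Binary.PropositionalEquality as ≡ using (_≡_)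

module Sums {c ℓ : Level} (S : Semiring c ℓ) where
  open Semiring S
  open import Algebra.Properties.CommutativeSemigroup +-commutativeSemigroup using (interchange)
  open import Relation.Binary.Reasoning.Setoid setoid

  sumTo : ℕ → (ℕ → Carrier) → Carrier
  sumTo zero    f = 0#
  sumTo (suc n) f = sumTo n f + f n

  infixl 10 sumTo
  syntax sumTo n (λ i → x) = ∑[ i < n ] x

  ∑-cong : ∀ n {f g : ℕ → Carrier} → (∀ i → i < n → f i ≈ g i) → ∑[ i < n ] f i ≈ ∑[ i < n ] g i
  ∑-cong zero    eq = refl
  ∑-cong (suc n) eq = +-cong (∑-cong n (λ i i<n → eq i (m<n⇒m<1+n i<n))) (eq n (n<1+n n))

  ∑-zero : ∀ n {f : ℕ → Carrier} → (∀ i → i < n → f i ≈ 0#) → ∑[ i < n ] f i ≈ 0#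
  ∑-zero zero    eq = refl
  ∑-zero (suc n) eq = trans (+-cong (∑-zero n (λ i i<n → eq i (m<n⇒m<1+n i<n))) (eq n (n<1+n n)))
                            (+-identityʳ 0#)

  ∑-distrib-+ : ∀ n (f g : ℕ → Carrier) → ∑[ i < n ] (f i + g i) ≈ ∑[ i < n ] f i + ∑[ i < n ] g i
  ∑-distrib-+ zero    f g = sym (+-identityʳ 0#)
  ∑-distrib-+ (suc n) f g = trans (+-congʳ (∑-distrib-+ n f g)) (interchange _ _ _ _)

  *-distribˡ-∑ : ∀ n a (f : ℕ → Carrier) → a * ∑[ i < n ] f i ≈ ∑[ i < n ] (a * f i)
  *-distribˡ-∑ zero    a f = zeroʳ a
  *-distribˡ-∑ (suc n) a f = trans (distribˡ a _ _) (+-congʳ (*-distribˡ-∑ n a f))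

  *-distribʳ-∑ : ∀ n a (f : ℕ → Carrier) → (∑[ i < n ] f i) * a ≈ ∑[ i < n ] (f i * a)
  *-distribʳ-∑ zero    a f = zeroˡ a
  *-distribʳ-∑ (suc n) a f = trans (distribʳ a _ _) (+-congʳ (*-distribʳ-∑ n a f))

  ∑-comm : ∀ m n (f : ℕ → ℕ → Carrier) →
           ∑[ i < m ] ∑[ j < n ] f i j ≈ ∑[ j < n ] ∑[ i < m ] f i j
  ∑-comm zero    n f = sym (∑-zero n (λ _ _ → refl))
  ∑-comm (suc m) n f = trans (+-congʳ (∑-comm m n f)) (sym (∑-distrib-+ n _ _))

  ∑-head : ∀ n (f : ℕ → Carrier) → ∑[ i < suc n ] f i ≈ f 0 + ∑[ i < n ] f (suc i)
  ∑-head zero    f = trans (+-identityˡ _) (sym (+-identityʳ _))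
  ∑-head (suc n) f = trans (+-congʳ (∑-head n f)) (+-assoc _ _ _)

  ∑-split : ∀ m n (f : ℕ → Carrier) → ∑[ i < m ℕ.+ n ] f i ≈ ∑[ i < m ] f i + ∑[ i < n ] f (m ℕ.+ i)
  ∑-split m zero    f = ≡.subst (λ k → ∑[ i < k ] f i ≈ ∑[ i < m ] f i + 0#)
                                (≡.sym (ℕP.+-identityʳ m)) (sym (+-identityʳ _))
  ∑-split m (suc n) f = ≡.subst (λ k → ∑[ i < k ] f i ≈ ∑[ i < m ] f i + ∑[ i < suc n ] f (m ℕ.+ i))
                                (≡.sym (ℕP.+-suc m n))
                                (trans (+-congʳ (∑-split m n f)) (+-assoc _ _ _))

module PowerSeries {c ℓ : Level} (R : CommutativeRing c ℓ) where
  open CommutativeRing R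
  open Sums semiring
  open import Algebra.Properties.Semiring.Mult semiring using (_×_; ×-homo-+)
  open import Algebra.Properties.CommutativeSemigroup *-commutativeSemigroup using (x∙yz≈y∙xz)
  open import Algebra.Properties.Group +-group using (inverseʳ-unique; ∙-cancelʳ)
  open import Relation.Binary.Reasoning.Setoid setoid

  Series : Set c
  Series = ℕ → Carrier

  1ˢ : Series
  1ˢ zero    = 1#
  1ˢ (suc _) = 0#

  infixl 6 _+ˢ_
  infixl 7 _*ˢ_
  infixr 8 _^ˢ_

  _+ˢ_ : Series → Series → Series
  (f +ˢ g) n = f n + g n

  _*ˢ_ : Series → Series → Series
  (f *ˢ g) n = ∑[ j < suc n ] (f j * g (n ∸ j))

  _^ˢ_ : Series → ℕ → Series
  g ^ˢ zero  = 1ˢ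
  g ^ˢ suc k = g *ˢ g ^ˢ k

  *ˢ-congʳ-≤ : ∀ f {u v} n → (∀ m → m ≤ n → u m ≈ v m) → (f *ˢ u) n ≈ (f *ˢ v) n
  *ˢ-congʳ-≤ f n eq = ∑-cong (suc n) (λ j _ → *-congˡ (eq (n ∸ j) (m∸n≤m n j)))

  *ˢ-head : ∀ f u n → (f *ˢ u) n ≈ f 0 * u n + ∑[ j < n ] (f (suc j) * u (n ∸ suc j))
  *ˢ-head f u n = ∑-head n (λ j → f j * u (n ∸ j))

  *ˢ-identityˡ : ∀ u n → (1ˢ *ˢ u) n ≈ u n
  *ˢ-identityˡ u n = begin
    (1ˢ *ˢ u) n                                 ≈⟨ *ˢ-head 1ˢ u n ⟩
    1# * u n + ∑[ j < n ] (0# * u (n ∸ suc j))  ≈⟨ +-cong (*-identityˡ (u n)) (∑-zero n (λ _ _ → zeroˡ _)) ⟩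
    u n + 0#                                    ≈⟨ +-identityʳ (u n) ⟩
    u n                                         ∎

  *ˢ-distribʳ : ∀ f g u n → ((f +ˢ g) *ˢ u) n ≈ (f *ˢ u) n + (g *ˢ u) n
  *ˢ-distribʳ f g u n = trans (∑-cong (suc n) (λ j _ → distribʳ _ _ _)) (∑-distrib-+ (suc n) _ _)

  *ˢ-linearʳ : ∀ f B (a : ℕ → Carrier) (Q : ℕ → Series) n →
               (f *ˢ (λ m → ∑[ k < B ] (a k * Q k m))) n ≈ ∑[ k < B ] (a k * (f *ˢ Q k) n)
  *ˢ-linearʳ f B a Q n = begin
    ∑[ j < suc n ] (f j * ∑[ k < B ] (a k * Q k (n ∸ j)))
      ≈⟨ ∑-cong (suc n) (λ j _ → *-distribˡ-∑ B (f j) _) ⟩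
    ∑[ j < suc n ] ∑[ k < B ] (f j * (a k * Q k (n ∸ j)))
      ≈⟨ ∑-comm (suc n) B _ ⟩
    ∑[ k < B ] ∑[ j < suc n ] (f j * (a k * Q k (n ∸ j)))
      ≈⟨ ∑-cong B (λ k _ → ∑-cong (suc n) (λ j _ → x∙yz≈y∙xz _ _ _)) ⟩
    ∑[ k < B ] ∑[ j < suc n ] (a k * (f j * Q k (n ∸ j)))
      ≈⟨ ∑-cong B (λ k _ → sym (*-distribˡ-∑ (suc n) (a k) _)) ⟩
    ∑[ k < B ] (a k * (f *ˢ Q k) n) ∎

  *ˢ-shiftˡ : ∀ f u R n → (∀ j → j < R → f j ≈ 0#) → (f *ˢ u) (R ℕ.+ n) ≈ ((λ j → f (R ℕ.+ j)) *ˢ u) n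
  *ˢ-shiftˡ f u R n f<R≈0 = begin
    ∑[ j < suc (R ℕ.+ n) ] (f j * u (R ℕ.+ n ∸ j))
      ≡⟨ ≡.cong (λ k → sumTo k (λ j → f j * u (R ℕ.+ n ∸ j))) (ℕP.+-suc R n) ⟨
    ∑[ j < R ℕ.+ suc n ] (f j * u (R ℕ.+ n ∸ j))
      ≈⟨ ∑-split R (suc n) _ ⟩
    ∑[ j < R ] (f j * u (R ℕ.+ n ∸ j)) + ∑[ j < suc n ] (f (R ℕ.+ j) * u (R ℕ.+ n ∸ (R ℕ.+ j)))
      ≈⟨ +-cong (∑-zero R (λ j j<R → trans (*-congʳ (f<R≈0 j j<R)) (zeroˡ _)))
                (∑-cong (suc n) (λ j _ → *-congˡ (reflexive (≡.cong u (ℕP.[m+n]∸[m+o]≡n∸o R n j))))) ⟩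
    0# + ((λ j → f (R ℕ.+ j)) *ˢ u) n
      ≈⟨ +-identityˡ _ ⟩
    ((λ j → f (R ℕ.+ j)) *ˢ u) n ∎

  *-cancelˡ-invertible : ∀ {a c x y} → c * a ≈ 1# → a * x ≈ a * y → x ≈ y
  *-cancelˡ-invertible {a} {c} {x} {y} ca≈1 ax≈ay = begin
    x             ≈⟨ *-identityˡ x ⟨
    1# * x        ≈⟨ *-congʳ ca≈1 ⟨
    (c * a) * x   ≈⟨ *-assoc c a x ⟩
    c * (a * x)   ≈⟨ *-congˡ ax≈ay ⟩
    c * (a * y)   ≈⟨ *-assoc c a y ⟨
    (c * a) * y   ≈⟨ *-congʳ ca≈1 ⟩
    1# * y        ≈⟨ *-identityˡ y ⟩
    y             ∎

  *ˢ-cancelˡ-≤ : ∀ {g u v c} n → c * g 0 ≈ 1# →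
                 (∀ m → m ≤ n → (g *ˢ u) m ≈ (g *ˢ v) m) → ∀ m → m ≤ n → u m ≈ v m
  *ˢ-cancelˡ-≤ {g} {u} {v} n cg₀≈1 eq = <-rec (λ m → m ≤ n → u m ≈ v m) step
    where
    step : ∀ m → (∀ {m′} → m′ < m → m′ ≤ n → u m′ ≈ v m′) → m ≤ n → u m ≈ v m
    step m ih m≤n = *-cancelˡ-invertible cg₀≈1 (∙-cancelʳ (rest v) _ _ (begin
      g 0 * u m + rest v   ≈⟨ +-congˡ rest-u≈rest-v ⟨
      g 0 * u m + rest u   ≈⟨ *ˢ-head g u m ⟨
      (g *ˢ u) m           ≈⟨ eq m m≤n ⟩
      (g *ˢ v) m           ≈⟨ *ˢ-head g v m ⟩
      g 0 * v m + rest v   ∎))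
      where
      rest : Series → Carrier
      rest w = ∑[ j < m ] (g (suc j) * w (m ∸ suc j))
      rest-u≈rest-v : rest u ≈ rest v
      rest-u≈rest-v = ∑-cong m (λ j j<m → *-congˡ
        (ih (ℕP.∸-monoʳ-< (s≤s z≤n) j<m) (ℕP.≤-trans (m∸n≤m m (suc j)) m≤n)))

  ^ˢ-vanishes : ∀ h → h 0 ≈ 0# → ∀ k m → m < k → (h ^ˢ k) m ≈ 0#
  ^ˢ-vanishes h h₀≈0 (suc k) m m<1+k = begin
    (h *ˢ h ^ˢ k) m
      ≈⟨ *ˢ-head h (h ^ˢ k) m ⟩
    h 0 * (h ^ˢ k) m + ∑[ j < m ] (h (suc j) * (h ^ˢ k) (m ∸ suc j))
      ≈⟨ +-cong (trans (*-congʳ h₀≈0) (zeroˡ _)) (∑-zero m λ j j<m →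
           trans (*-congˡ (^ˢ-vanishes h h₀≈0 k _ (m∸1+j<k j<m))) (zeroʳ _)) ⟩
    0# + 0#
      ≈⟨ +-identityʳ 0# ⟩
    0# ∎
    where
    m∸1+j<k : ∀ {j} → j < m → m ∸ suc j < k
    m∸1+j<k j<m = ℕP.<-≤-trans (ℕP.∸-monoʳ-< (s≤s z≤n) j<m) (ℕP.≤-pred m<1+k)

  binom : ℕ → ℕ → Carrier
  binom n k = (n C k) × 1#

  binom-0 : ∀ n → binom n 0 ≈ 1#
  binom-0 n = +-identityʳ 1#

  binom-pascal : ∀ n k → binom (suc n) (suc k) ≈ binom n (suc k) + binom n k
  binom-pascal n k = begin
    (suc n C suc k) × 1#               ≡⟨ ≡.cong (_× 1#) (nCk+nC[k+1]≡[n+1]C[k+1] n k) ⟨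
    (n C k ℕ.+ n C suc k) × 1#         ≈⟨ ×-homo-+ 1# (n C k) (n C suc k) ⟩
    binom n k + binom n (suc k)        ≈⟨ +-comm _ _ ⟩
    binom n (suc k) + binom n k        ∎

  binomial : ∀ g M B m → M < B → ((1ˢ +ˢ g) ^ˢ M) m ≈ ∑[ j < B ] (binom M j * (g ^ˢ j) m)
  binomial g zero (suc B) m _ = begin
    1ˢ m                                                 ≈⟨ *-identityˡ (1ˢ m) ⟨
    1# * 1ˢ m                                            ≈⟨ *-congʳ (binom-0 0) ⟨
    binom 0 0 * 1ˢ m                                     ≈⟨ +-identityʳ _ ⟨
    binom 0 0 * 1ˢ m + 0#                                ≈⟨ +-congˡ (∑-zero B (λ _ _ → zeroˡ _)) ⟨
    binom 0 0 * 1ˢ m + ∑[ j < B ] (0# * (g ^ˢ suc j) m)  ≈⟨ ∑-head B _ ⟨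
    ∑[ j < suc B ] (binom 0 j * (g ^ˢ j) m)              ∎
  binomial g (suc M) (suc B) m (s≤s M<B) = begin
    ((1ˢ +ˢ g) *ˢ X) m
      ≈⟨ *ˢ-distribʳ 1ˢ g X m ⟩
    (1ˢ *ˢ X) m + (g *ˢ X) m
      ≈⟨ +-cong (*ˢ-identityˡ X m) (*ˢ-congʳ-≤ g m (λ m′ _ → binomial g M B m′ M<B)) ⟩
    X m + (g *ˢ (λ m′ → ∑[ j < B ] (binom M j * (g ^ˢ j) m′))) m
      ≈⟨ +-cong (binomial g M (suc B) m (m<n⇒m<1+n M<B)) (*ˢ-linearʳ g B (binom M) (g ^ˢ_) m) ⟩
    ∑[ j < suc B ] (binom M j * (g ^ˢ j) m) + ∑[ j < B ] (binom M j * (g ^ˢ suc j) m)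
      ≈⟨ +-congʳ (∑-head B _) ⟩
    (binom M 0 * 1ˢ m + ∑[ j < B ] (binom M (suc j) * (g ^ˢ suc j) m)) + ∑[ j < B ] (binom M j * (g ^ˢ suc j) m)
      ≈⟨ +-assoc _ _ _ ⟩
    binom M 0 * 1ˢ m + (∑[ j < B ] (binom M (suc j) * (g ^ˢ suc j) m) + ∑[ j < B ] (binom M j * (g ^ˢ suc j) m))
      ≈⟨ +-congˡ (∑-distrib-+ B _ _) ⟨
    binom M 0 * 1ˢ m + ∑[ j < B ] (binom M (suc j) * (g ^ˢ suc j) m + binom M j * (g ^ˢ suc j) m)
      ≈⟨ +-congˡ (∑-cong B (λ j _ → trans (*-congʳ (binom-pascal M j)) (distribʳ _ _ _))) ⟨
    binom (suc M) 0 * 1ˢ m + ∑[ j < B ] (binom (suc M) (suc j) * (g ^ˢ suc j) m)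
      ≈⟨ ∑-head B _ ⟨
    ∑[ j < suc B ] (binom (suc M) j * (g ^ˢ j) m) ∎
    where
    X : Series
    X = (1ˢ +ˢ g) ^ˢ M

  truncatedNegInverse : Series → ℕ → Series
  truncatedNegInverse g n m = ∑[ k < suc n ] (binom (suc n) (suc k) * (g ^ˢ k) m)

  -- (1 + g)^(n+1) = 1 + g · truncatedNegInverse g n, and the left side is O(x^(n+1)).
  *ˢ-truncatedNegInverse : ∀ g n → g 0 ≈ - 1# → ∀ m → m ≤ n →
                           (g *ˢ truncatedNegInverse g n) m ≈ - 1ˢ m
  *ˢ-truncatedNegInverse g n g₀≈-1 m m≤n = inverseʳ-unique (1ˢ m) _ (begin
    1ˢ m + (g *ˢ truncatedNegInverse g n) m
      ≈⟨ +-cong (sym (trans (*-congʳ (binom-0 (suc n))) (*-identityˡ (1ˢ m))))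
                (*ˢ-linearʳ g (suc n) (binom (suc n) ∘ suc) (g ^ˢ_) m) ⟩
    binom (suc n) 0 * 1ˢ m + ∑[ k < suc n ] (binom (suc n) (suc k) * (g ^ˢ suc k) m)
      ≈⟨ ∑-head (suc n) _ ⟨
    ∑[ j < suc (suc n) ] (binom (suc n) j * (g ^ˢ j) m)
      ≈⟨ binomial g (suc n) (suc (suc n)) m ℕP.≤-refl ⟨
    ((1ˢ +ˢ g) ^ˢ suc n) m
      ≈⟨ ^ˢ-vanishes (1ˢ +ˢ g) (trans (+-congˡ g₀≈-1) (-‿inverseʳ 1#)) (suc n) m (s≤s m≤n) ⟩
    0# ∎)

module FieldFacts {c ℓ : Level} (K : Field c ℓ) where
  open Field K
  open FieldOps K
  open Sums semiring
  open import Algebra.Properties.CommutativeSemigroup *-commutativeSemigroup using (interchange; x∙yz≈y∙xz)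
  open import Algebra.Properties.Semiring.Mult semiring using (_×_)
  open import Algebra.Properties.Ring ring using (-1*x≈-x)
  open import Algebra.Properties.Group +-group using (⁻¹-involutive)
  open import Relation.Binary.Reasoning.Setoid setoid

  when-yes : ∀ {p} {P : Set p} (P? : Dec P) {x} → P → when P? x ≈ x
  when-yes (yes _) _ = refl
  when-yes (no ¬p) p = ⊥-elim (¬p p)

  when-no : ∀ {p} {P : Set p} (P? : Dec P) {x} → ¬ P → when P? x ≈ 0#
  when-no (yes p) ¬p = ⊥-elim (¬p p)
  when-no (no _)  _  = refl

  when-cong : ∀ {p} {P : Set p} (P? : Dec P) {x y} → x ≈ y → when P? x ≈ when P? y
  when-cong (yes _) x≈y = x≈y
  when-cong (no _)  _   = refl

  *-when : ∀ {p} {P : Set p} (P? : Dec P) a x → a * when P? x ≈ when P? (a * x)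
  *-when (yes _) a x = refl
  *-when (no _)  a x = zeroʳ a

  when-* : ∀ {p} {P : Set p} (P? : Dec P) a x → when P? x * a ≈ when P? (x * a)
  when-* (yes _) a x = refl
  when-* (no _)  a x = zeroˡ a

  when-⇔ : ∀ {p q} {P : Set p} {Q : Set q} (P? : Dec P) (Q? : Dec Q) {x} → (P → Q) → (Q → P) →
           when P? x ≈ when Q? x
  when-⇔ (yes p) Q? P→Q _   = sym (when-yes Q? (P→Q p))
  when-⇔ (no ¬p) Q? _   Q→P = sym (when-no Q? (¬p ∘ Q→P))

  module _ {p} {P : ℕ → Set p} (P? : Decidable P) (f : ℕ → Carrier) where

    ∑-when-none : ∀ B → (∀ j → j < B → ¬ P j) → ∑[ j < B ] when (P? j) (f j) ≈ 0#
    ∑-when-none B none = ∑-zero B (λ j j<B → when-no (P? j) (none j j<B))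

    ∑-when-unique : ∀ {j₀} B → j₀ < B → P j₀ → (∀ {j} → P j → j ≡ j₀) →
                    ∑[ j < B ] when (P? j) (f j) ≈ f j₀
    ∑-when-unique (suc B) j₀<1+B pj₀ unique with ℕP.m≤n⇒m<n∨m≡n (ℕP.≤-pred j₀<1+B)
    ... | inj₁ j₀<B = begin
      ∑[ j < B ] when (P? j) (f j) + when (P? B) (f B)
        ≈⟨ +-cong (∑-when-unique B j₀<B pj₀ unique) (when-no (P? B) (ℕP.<⇒≢ j₀<B ∘ ≡.sym ∘ unique)) ⟩
      _ + 0#
        ≈⟨ +-identityʳ _ ⟩
      _ ∎
    ... | inj₂ ≡.refl = begin
      ∑[ j < B ] when (P? j) (f j) + when (P? B) (f B)
        ≈⟨ +-cong (∑-when-none B (λ j j<B → ℕP.<⇒≢ j<B ∘ unique)) (when-yes (P? B) pj₀) ⟩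
      0# + f B
        ≈⟨ +-identityˡ (f B) ⟩
      f B ∎

    ∑-when-truncate : ∀ {B B′} → B′ ≤ B → (∀ {j} → P j → j < B′) →
                      ∑[ j < B ] when (P? j) (f j) ≈ ∑[ j < B′ ] when (P? j) (f j)
    ∑-when-truncate {B′ = B′} B′≤B bound with ℕP.m≤n⇒∃[o]m+o≡n B′≤B
    ... | o , ≡.refl = begin
      ∑[ j < B′ ℕ.+ o ] when (P? j) (f j)
        ≈⟨ ∑-split B′ o _ ⟩
      ∑[ j < B′ ] when (P? j) (f j) + ∑[ j < o ] when (P? (B′ ℕ.+ j)) (f (B′ ℕ.+ j))
        ≈⟨ +-congˡ (∑-zero o (λ j _ → when-no (P? _) (λ p → ℕP.<⇒≱ (bound p) (ℕP.m≤m+n B′ j)))) ⟩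
      ∑[ j < B′ ] when (P? j) (f j) + 0#
        ≈⟨ +-identityʳ _ ⟩
      ∑[ j < B′ ] when (P? j) (f j) ∎

    ∑-when-rebound : ∀ {B₁ B₂} → (∀ {j} → P j → j < B₁) → (∀ {j} → P j → j < B₂) →
                     ∑[ j < B₁ ] when (P? j) (f j) ≈ ∑[ j < B₂ ] when (P? j) (f j)
    ∑-when-rebound {B₁} {B₂} bound₁ bound₂ =
      trans (∑-when-truncate (ℕP.m⊓n≤m B₁ B₂) bound)
            (sym (∑-when-truncate (ℕP.m⊓n≤n B₁ B₂) bound))
      where
      bound : ∀ {j} → P j → j < B₁ ℕ.⊓ B₂
      bound p = ℕP.⊓-glb (bound₁ p) (bound₂ p)

  sumL-++ : ∀ xs ys → sumL (xs ++ ys) ≈ sumL xs + sumL ys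
  sumL-++ []       ys = sym (+-identityˡ _)
  sumL-++ (x ∷ xs) ys = trans (+-congˡ (sumL-++ xs ys)) (sym (+-assoc _ _ _))

  module _ {a} {A : Set a} where

    sumL-map-cong : ∀ (xs : List A) {f g : A → Carrier} → (∀ x → f x ≈ g x) →
                    sumL (List.map f xs) ≈ sumL (List.map g xs)
    sumL-map-cong []       eq = refl
    sumL-map-cong (x ∷ xs) eq = +-cong (eq x) (sumL-map-cong xs eq)

    sumL-map-zero : ∀ (xs : List A) {f : A → Carrier} → (∀ x → f x ≈ 0#) → sumL (List.map f xs) ≈ 0#
    sumL-map-zero []       eq = refl
    sumL-map-zero (x ∷ xs) eq = trans (+-cong (eq x) (sumL-map-zero xs eq)) (+-identityʳ 0#)

    *-distribˡ-sumL : ∀ (xs : List A) a (f : A → Carrier) →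
                      a * sumL (List.map f xs) ≈ sumL (List.map (λ x → a * f x) xs)
    *-distribˡ-sumL []       a f = zeroʳ a
    *-distribˡ-sumL (x ∷ xs) a f = trans (distribˡ a _ _) (+-congˡ (*-distribˡ-sumL xs a f))

    sumL-concatMap : ∀ {b} {B : Set b} (F : A → List B) (h : B → Carrier) (xs : List A) →
                     sumL (List.map h (List.concatMap F xs)) ≈ sumL (List.map (λ x → sumL (List.map h (F x))) xs)
    sumL-concatMap F h []       = refl
    sumL-concatMap F h (x ∷ xs) = begin
      sumL (List.map h (F x ++ List.concatMap F xs))
        ≡⟨ ≡.cong sumL (Listₚ.map-++ h (F x) _) ⟩
      sumL (List.map h (F x) ++ List.map h (List.concatMap F xs))
        ≈⟨ sumL-++ (List.map h (F x)) _ ⟩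
      sumL (List.map h (F x)) + sumL (List.map h (List.concatMap F xs))
        ≈⟨ +-congˡ (sumL-concatMap F h xs) ⟩
      sumL (List.map (λ x → sumL (List.map h (F x))) (x ∷ xs)) ∎

  ∑<≈∑ : ∀ n f → ∑< n f ≈ ∑[ i < n ] f i
  ∑<≈∑ n f = sumL-applyUpTo n id
    where
    sumL-applyUpTo : ∀ n g → sumL (List.map f (List.applyUpTo g n)) ≈ ∑[ i < n ] f (g i)
    sumL-applyUpTo zero    g = refl
    sumL-applyUpTo (suc n) g =
      trans (+-congˡ (sumL-applyUpTo n (g ∘ suc))) (sym (∑-head n (f ∘ g)))

  open PowerSeries commutativeRing using (*-cancelˡ-invertible)

  fromℕ≈×1# : ∀ m → fromℕ m ≈ m × 1#
  fromℕ≈×1# zero    = refl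
  fromℕ≈×1# (suc m) = +-congˡ (fromℕ≈×1# m)

  ⁻¹-inverseˡ : ∀ x → x ≉ 0# → x ⁻¹ * x ≈ 1#
  ⁻¹-inverseˡ x x≉0 = trans (*-comm _ x) (⁻¹-inverse x x≉0)

  *-≉0 : ∀ {x y} → x ≉ 0# → y ≉ 0# → x * y ≉ 0#
  *-≉0 {x} x≉0 y≉0 xy≈0 = y≉0 (*-cancelˡ-invertible (⁻¹-inverseˡ x x≉0) (trans xy≈0 (sym (zeroʳ x))))

  ^ᴷ-≉0 : ∀ {x} → x ≉ 0# → ∀ k → x ^ᴷ k ≉ 0#
  ^ᴷ-≉0 x≉0 zero    = 1≉0
  ^ᴷ-≉0 x≉0 (suc k) = *-≉0 x≉0 (^ᴷ-≉0 x≉0 k)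

  x≈y*[x÷y] : ∀ {x y} → y ≉ 0# → x ≈ y * (x ÷ y)
  x≈y*[x÷y] {x} {y} y≉0 = trans (sym (*-identityʳ x))
    (trans (*-congˡ (sym (⁻¹-inverse y y≉0))) (x∙yz≈y∙xz x y (y ⁻¹)))

  ⁻¹-unique : ∀ {x y} → x ≉ 0# → x * y ≈ 1# → x ⁻¹ ≈ y
  ⁻¹-unique {x} x≉0 xy≈1 = *-cancelˡ-invertible (⁻¹-inverseˡ x x≉0) (trans (⁻¹-inverse x x≉0) (sym xy≈1))

  1⁻¹≈1 : 1# ⁻¹ ≈ 1#
  1⁻¹≈1 = ⁻¹-unique 1≉0 (*-identityˡ 1#)

  ⁻¹-distrib-* : ∀ {x y} → x ≉ 0# → y ≉ 0# → (x * y) ⁻¹ ≈ x ⁻¹ * y ⁻¹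
  ⁻¹-distrib-* {x} {y} x≉0 y≉0 = ⁻¹-unique (*-≉0 x≉0 y≉0) (begin
    (x * y) * (x ⁻¹ * y ⁻¹)   ≈⟨ interchange x y (x ⁻¹) (y ⁻¹) ⟩
    (x * x ⁻¹) * (y * y ⁻¹)   ≈⟨ *-cong (⁻¹-inverse x x≉0) (⁻¹-inverse y y≉0) ⟩
    1# * 1#                   ≈⟨ *-identityˡ 1# ⟩
    1#                        ∎)

  ^ᴷ-+ : ∀ x m n → x ^ᴷ (m ℕ.+ n) ≈ x ^ᴷ m * x ^ᴷ n
  ^ᴷ-+ x zero    n = sym (*-identityˡ _)
  ^ᴷ-+ x (suc m) n = trans (*-congˡ (^ᴷ-+ x m n)) (sym (*-assoc _ _ _))

  -1^n*-1^n≈1 : ∀ n → (- 1#) ^ᴷ n * (- 1#) ^ᴷ n ≈ 1#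
  -1^n*-1^n≈1 zero    = *-identityˡ 1#
  -1^n*-1^n≈1 (suc n) = begin
    (- 1# * s) * (- 1# * s)   ≈⟨ interchange (- 1#) s (- 1#) s ⟩
    (- 1# * - 1#) * (s * s)   ≈⟨ *-cong (trans (-1*x≈-x (- 1#)) (⁻¹-involutive 1#)) (-1^n*-1^n≈1 n) ⟩
    1# * 1#                   ≈⟨ *-identityˡ 1# ⟩
    1#                        ∎
    where
    s : Carrier
    s = (- 1#) ^ᴷ n

module PowersOf (r : ℕ) (1<r : 1 < r) where
  open import Data.Nat using (_^_; _+_; _*_)
  open ℕP.≤-Reasoning

  instance
    r≢0 : ℕ.NonZero r
    r≢0 = ℕ.>-nonZero (ℕP.<-trans (s≤s z≤n) 1<r)

  r^m+n≤r^[m+n] : ∀ m n → r ^ m + n ≤ r ^ (m + n)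
  r^m+n≤r^[m+n] m zero = ℕP.≤-reflexive (≡.trans (ℕP.+-identityʳ _) (≡.cong (r ^_) (≡.sym (ℕP.+-identityʳ m))))
  r^m+n≤r^[m+n] m (suc n) = begin
    r ^ m + suc n            ≡⟨ ℕP.+-suc (r ^ m) n ⟩
    suc (r ^ m + n)          ≤⟨ s≤s (r^m+n≤r^[m+n] m n) ⟩
    suc x                    ≤⟨ ℕP.+-monoˡ-≤ x (ℕP.m^n>0 r (m + n)) ⟩
    x + x                    ≡⟨ ≡.cong (x +_) (ℕP.+-identityʳ x) ⟨
    2 * x                    ≤⟨ ℕP.*-monoˡ-≤ x 1<r ⟩
    r * x                    ≡⟨ ≡.cong (r ^_) (ℕP.+-suc m n) ⟨
    r ^ (m + suc n)          ∎
    where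
    x : ℕ
    x = r ^ (m + n)

  n<r^n : ∀ n → n < r ^ n
  n<r^n = r^m+n≤r^[m+n] 0

  ^-cancelʳ-< : ∀ {a b} → r ^ a < r ^ b → a < b
  ^-cancelʳ-< {a} {b} r^a<r^b with a ℕ.<? b
  ... | yes a<b = a<b
  ... | no  a≮b = ⊥-elim (ℕP.<⇒≱ r^a<r^b (ℕP.^-monoʳ-≤ r (ℕP.≮⇒≥ a≮b)))

  r^i<r^N+B⇒i<N+B : ∀ {i} N B → r ^ i < r ^ N + B → i < N + B
  r^i<r^N+B⇒i<N+B N B lt = ^-cancelʳ-< (ℕP.<-≤-trans lt (r^m+n≤r^[m+n] N B))

module Nonvanishing {c ℓ : Level} (K : Field c ℓ) (r : ℕ) (T : Field.Carrier K) (1<r : 1 < r)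
                    (rf : IsRationalFunctionField K r T) where
  open Field K
  open FieldOps K
  open Carlitz K r T
  open FieldFacts K
  open IsRationalFunctionField rf
  open PowersOf r 1<r using (r^m+n≤r^[m+n])
  open import Algebra.Properties.Group +-group using (⁻¹-involutive; ε⁻¹≈ε)
  open import Data.List.Relation.Unary.All using (_∷_)
  open import Relation.Binary.Reasoning.Setoid setoid

  private
    0ᶠ 1ᶠ -1ᶠ : Fin r
    0ᶠ = proj₁ emb-0
    1ᶠ = proj₁ emb-1
    -1ᶠ = proj₁ (emb-neg 1ᶠ)

    Xᵏ : ℕ → List (Fin r)
    Xᵏ k = List.replicate k 0ᶠ ++ 1ᶠ ∷ []

  evalPoly-Xᵏ : ∀ k → evalPoly (List.map emb (Xᵏ k)) T ≈ T ^ᴷ k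
  evalPoly-Xᵏ zero    = trans (+-cong (proj₂ emb-1) (zeroʳ T)) (+-identityʳ 1#)
  evalPoly-Xᵏ (suc k) = trans (+-cong (proj₂ emb-0) (*-congˡ (evalPoly-Xᵏ k))) (+-identityˡ _)

  evalPoly-X²⁺ᵏ-X : ∀ k → evalPoly (List.map emb (0ᶠ ∷ -1ᶠ ∷ Xᵏ k)) T ≈ T ^ᴷ (2 ℕ.+ k) - T
  evalPoly-X²⁺ᵏ-X k = begin
    emb 0ᶠ + T * (emb -1ᶠ + T * evalPoly (List.map emb (Xᵏ k)) T)
      ≈⟨ +-cong (proj₂ emb-0) (*-congˡ (+-cong (trans (proj₂ (emb-neg 1ᶠ)) (-‿cong (proj₂ emb-1)))
                                                (*-congˡ (evalPoly-Xᵏ k)))) ⟩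
    0# + T * (- 1# + T ^ᴷ (suc k))
      ≈⟨ trans (+-identityˡ _) (distribˡ T (- 1#) _) ⟩
    T * - 1# + T ^ᴷ (2 ℕ.+ k)
      ≈⟨ +-comm _ _ ⟩
    T ^ᴷ (2 ℕ.+ k) + T * - 1#
      ≈⟨ +-congˡ (trans (*-comm T (- 1#)) (-1*x≈-x T)) ⟩
    T ^ᴷ (2 ℕ.+ k) - T ∎
    where open import Algebra.Properties.Ring ring using (-1*x≈-x)

  -- [i+1] is the value at T of the polynomial X^(r^(i+1)) - X, whose X-coefficient is -1.
  bracket≉0 : ∀ i → bracket (suc i) ≉ 0#
  bracket≉0 i [i+1]≈0 with ℕP.m≤n⇒∃[o]m+o≡n (ℕP.≤-trans (s≤s (s≤s z≤n)) (r^m+n≤r^[m+n] 0 (suc i)))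
  ... | k , 2+k≡r^[i+1] with transcendental (0ᶠ ∷ -1ᶠ ∷ Xᵏ k)
        (trans (evalPoly-X²⁺ᵏ-X k) (trans (+-congʳ (reflexive (≡.cong (T ^ᴷ_) 2+k≡r^[i+1]))) [i+1]≈0))
  ... | _ ∷ -1ᶠ≈0 ∷ _ = 1≉0 (begin
    1#        ≈⟨ ⁻¹-involutive 1# ⟨
    - - 1#    ≈⟨ -‿cong (trans (-‿cong (sym (proj₂ emb-1))) (trans (sym (proj₂ (emb-neg 1ᶠ))) -1ᶠ≈0)) ⟩
    - 0#      ≈⟨ ε⁻¹≈ε ⟩
    0#        ∎)

  L≉0 : ∀ i → L i ≉ 0#
  L≉0 zero    = 1≉0
  L≉0 (suc i) = *-≉0 (bracket≉0 i) (L≉0 i)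

  D≉0 : ∀ i → D i ≉ 0#
  D≉0 zero    = 1≉0
  D≉0 (suc i) = *-≉0 (bracket≉0 i) (^ᴷ-≉0 (D≉0 i) r)

  Π≉0 : ∀ n → Π n ≉ 0#
  Π≉0 n = Π-aux≉0 r (suc n) 0 n
    where
    Π-aux≉0 : ∀ s fuel j n → Π-aux s fuel j n ≉ 0#
    Π-aux≉0 (suc (suc s)) (suc fuel) j n =
      *-≉0 (^ᴷ-≉0 (D≉0 j) (n ℕ.% suc (suc s))) (Π-aux≉0 (suc (suc s)) fuel (suc j) (n ℕ./ suc (suc s)))
    Π-aux≉0 zero                _          _ _ = 1≉0
    Π-aux≉0 (suc zero)          _          _ _ = 1≉0
    Π-aux≉0 (suc (suc s))       zero       _ _ = 1≉0

-- `tuples` is defined inside `Carlitz`.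
module Multinomial {c ℓ : Level} (K : Field c ℓ) (r : ℕ) (T : Field.Carrier K) where
  open Field K
  open FieldOps K
  open Carlitz K r T using (tuples)
  open FieldFacts K
  open Sums semiring
  open PowerSeries commutativeRing
  open import Data.Vec as Vec using (Vec)
  open import Relation.Binary.Reasoning.Setoid setoid

  exponentSum : (ℕ → ℕ) → ∀ {k} → Vec ℕ k → ℕ
  exponentSum e v = Vec.sum (Vec.map e v)

  coeffProduct : (ℕ → Carrier) → ∀ {k} → Vec ℕ k → Carrier
  coeffProduct a v = prodL (Vec.toList (Vec.map a v))

  module _ (e : ℕ → ℕ) (a : ℕ → Carrier) (B : ℕ) where

    tupleSum : ℕ → ℕ → Carrier
    tupleSum m k = sumL (List.map (λ v → when (exponentSum e v ≟ m) (coeffProduct a v)) (tuples B k))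

    tupleSum-cons : ∀ i m k →
      ∑[ j < suc m ] when (e i ≟ j) (a i * tupleSum (m ∸ j) k)
        ≈ sumL (List.map (λ v → when (e i ℕ.+ exponentSum e v ≟ m) (a i * coeffProduct a v)) (tuples B k))
    tupleSum-cons i m k with e i ℕ.≤? m
    ... | yes eᵢ≤m = begin
      ∑[ j < suc m ] when (e i ≟ j) (a i * tupleSum (m ∸ j) k)
        ≈⟨ ∑-when-unique (e i ≟_) (λ j → a i * tupleSum (m ∸ j) k) (suc m) (s≤s eᵢ≤m) ≡.refl ≡.sym ⟩
      a i * tupleSum (m ∸ e i) k
        ≈⟨ *-distribˡ-sumL (tuples B k) (a i) _ ⟩
      sumL (List.map (λ v → a i * when (exponentSum e v ≟ m ∸ e i) (coeffProduct a v)) (tuples B k))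
        ≈⟨ sumL-map-cong (tuples B k) (λ v → trans (*-when (exponentSum e v ≟ m ∸ e i) (a i) _)
             (when-⇔ (exponentSum e v ≟ m ∸ e i) (e i ℕ.+ exponentSum e v ≟ m)
               (λ E≡m∸eᵢ → ≡.trans (≡.cong (e i ℕ.+_) E≡m∸eᵢ) (ℕP.m+[n∸m]≡n eᵢ≤m))
               (λ eᵢ+E≡m → ≡.trans (≡.sym (ℕP.m+n∸m≡n (e i) _)) (≡.cong (_∸ e i) eᵢ+E≡m)))) ⟩
      sumL (List.map (λ v → when (e i ℕ.+ exponentSum e v ≟ m) (a i * coeffProduct a v)) (tuples B k)) ∎
    ... | no eᵢ≰m = begin
      ∑[ j < suc m ] when (e i ≟ j) (a i * tupleSum (m ∸ j) k)
        ≈⟨ ∑-when-none (e i ≟_) _ (suc m) (λ j j<1+m eᵢ≡j →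
             eᵢ≰m (≡.subst (_≤ m) (≡.sym eᵢ≡j) (ℕP.≤-pred j<1+m))) ⟩
      0#
        ≈⟨ sumL-map-zero (tuples B k) (λ v → when-no (e i ℕ.+ exponentSum e v ≟ m) (λ eᵢ+E≡m →
             eᵢ≰m (≡.subst (e i ℕ.≤_) eᵢ+E≡m (ℕP.m≤m+n (e i) _)))) ⟨
      sumL (List.map (λ v → when (e i ℕ.+ exponentSum e v ≟ m) (a i * coeffProduct a v)) (tuples B k)) ∎

    ^ˢ-coeff≈tupleSum : ∀ (g : Series) n → (∀ j → j ≤ n → g j ≈ ∑[ i < B ] when (e i ≟ j) (a i)) →
                        ∀ k m → m ≤ n → (g ^ˢ k) m ≈ tupleSum m k
    ^ˢ-coeff≈tupleSum g n g≈ zero zero    _ = sym (+-identityʳ 1#)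
    ^ˢ-coeff≈tupleSum g n g≈ zero (suc m) _ = sym (+-identityʳ 0#)
    ^ˢ-coeff≈tupleSum g n g≈ (suc k) m m≤n = begin
      (g *ˢ g ^ˢ k) m
        ≈⟨ *ˢ-congʳ-≤ g m (λ m′ m′≤m → ^ˢ-coeff≈tupleSum g n g≈ k m′ (ℕP.≤-trans m′≤m m≤n)) ⟩
      ∑[ j < suc m ] (g j * tupleSum (m ∸ j) k)
        ≈⟨ ∑-cong (suc m) (λ j j<1+m → trans (*-congʳ (g≈ j (ℕP.≤-trans (ℕP.≤-pred j<1+m) m≤n)))
                                              (*-distribʳ-∑ B _ _)) ⟩
      ∑[ j < suc m ] ∑[ i < B ] (when (e i ≟ j) (a i) * tupleSum (m ∸ j) k)
        ≈⟨ ∑-comm (suc m) B _ ⟩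
      ∑[ i < B ] ∑[ j < suc m ] (when (e i ≟ j) (a i) * tupleSum (m ∸ j) k)
        ≈⟨ ∑-cong B (λ i _ → trans (∑-cong (suc m) (λ j _ → when-* (e i ≟ j) _ _)) (tupleSum-cons i m k)) ⟩
      ∑[ i < B ] sumL (List.map (h ∘ (i Vec.∷_)) (tuples B k))
        ≈⟨ ∑<≈∑ B _ ⟨
      sumL (List.map (λ i → sumL (List.map (h ∘ (i Vec.∷_)) (tuples B k))) (List.upTo B))
        ≈⟨ sumL-map-cong (List.upTo B) (λ i → reflexive (≡.cong sumL (Listₚ.map-∘ (tuples B k)))) ⟩
      sumL (List.map (λ i → sumL (List.map h (List.map (i Vec.∷_) (tuples B k)))) (List.upTo B))
        ≈⟨ sumL-concatMap (λ i → List.map (i Vec.∷_) (tuples B k)) h (List.upTo B) ⟨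
      tupleSum m (suc k) ∎
      where
      h : Vec ℕ (suc k) → Carrier
      h v = when (exponentSum e v ≟ m) (coeffProduct a v)

module TruncatedCauchyCarlitz {c ℓ : Level} (K : Field c ℓ) (r : ℕ) (T : Field.Carrier K) (1<r : 1 < r)
                              (L≉0 : ∀ i → Field._≉_ K (Carlitz.L K r T i) (Field.0# K)) (N : ℕ) where
  open Field K
  open FieldOps K
  open Carlitz K r T
  open FieldFacts K
  open Sums semiring
  open PowerSeries commutativeRing
  open PowersOf r 1<r
  open Multinomial K r T
  open import Data.Nat using (_^_)
  open import Data.Vec as Vec using (Vec; []; _∷_)
  open import Algebra.Properties.AbelianGroup +-abelianGroup using (xyx⁻¹≈y)
  open import Algebra.Properties.CommutativeSemigroup *-commutativeSemigroup using (interchange)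
  open import Algebra.Properties.CommutativeSemigroup ℕP.+-commutativeSemigroup
    using () renaming (interchange to +-interchange)
  open import Algebra.Properties.Ring ring using (-‿distribˡ-*)
  open import Relation.Binary.Reasoning.Setoid setoid

  R : ℕ
  R = r ^ N

  logTerm : ℕ → Carrier
  logTerm i = sign i ÷ L i

  denCoeff≈∑ : ∀ m B → (∀ {i} → r ^ i ≡ m → i < N ℕ.+ B) →
               denCoeff N m ≈ ∑[ i < B ] when (r ^ (N ℕ.+ i) ≟ m) (logTerm (N ℕ.+ i))
  denCoeff≈∑ m B bound = begin
    logCoeff m - truncCoeff N m
      ≈⟨ +-cong (∑<≈∑ (suc m) W) (-‿cong (∑<≈∑ N W)) ⟩
    ∑[ i < suc m ] W i - ∑[ i < N ] W i
      ≈⟨ +-congʳ (∑-when-rebound (λ i → r ^ i ≟ m) logTerm below-1+m bound) ⟩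
    ∑[ i < N ℕ.+ B ] W i - ∑[ i < N ] W i
      ≈⟨ +-congʳ (∑-split N B W) ⟩
    ∑[ i < N ] W i + ∑[ i < B ] W (N ℕ.+ i) - ∑[ i < N ] W i
      ≈⟨ xyx⁻¹≈y _ _ ⟩
    ∑[ i < B ] W (N ℕ.+ i) ∎
    where
    W : ℕ → Carrier
    W i = when (r ^ i ≟ m) (logTerm i)
    below-1+m : ∀ {i} → r ^ i ≡ m → i < suc m
    below-1+m r^i≡m = ℕP.m<n⇒m<1+n (≡.subst (_ <_) r^i≡m (n<r^n _))

  denCoeff-below : ∀ m → m < R → denCoeff N m ≈ 0#
  denCoeff-below m m<R = denCoeff≈∑ m 0 λ r^i≡m →
    r^i<r^N+B⇒i<N+B N 0 (≡.subst (_< R ℕ.+ 0) (≡.sym r^i≡m) (ℕP.<-≤-trans m<R (ℕP.m≤m+n R 0)))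

  -- The factor -(-1)^N L_N normalises the constant term of D(x)/x^(r^N) to -1.
  scale : Carrier
  scale = - (sign N * L N)

  shiftedDen : Series
  shiftedDen j = scale * denCoeff N (R ℕ.+ j)

  exponent : ℕ → ℕ
  exponent i = r ^ (N ℕ.+ i) ∸ R

  coeff : ℕ → Carrier
  coeff i = - L N * (sign i ÷ L (N ℕ.+ i))

  scale*logTerm : ∀ i → scale * logTerm (N ℕ.+ i) ≈ coeff i
  scale*logTerm i = begin
    - (sN * LN) * (sign (N ℕ.+ i) * Lᵢ ⁻¹)   ≈⟨ *-congˡ (*-congʳ (^ᴷ-+ (- 1#) N i)) ⟩
    - (sN * LN) * ((sN * sᵢ) * Lᵢ ⁻¹)        ≈⟨ -‿distribˡ-* _ _ ⟨
    - ((sN * LN) * ((sN * sᵢ) * Lᵢ ⁻¹))      ≈⟨ -‿cong (*-congˡ (*-assoc sN sᵢ (Lᵢ ⁻¹))) ⟩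
    - ((sN * LN) * (sN * (sᵢ * Lᵢ ⁻¹)))      ≈⟨ -‿cong (interchange sN LN sN _) ⟩
    - ((sN * sN) * (LN * (sᵢ * Lᵢ ⁻¹)))      ≈⟨ -‿cong (trans (*-congʳ (-1^n*-1^n≈1 N)) (*-identityˡ _)) ⟩
    - (LN * (sᵢ * Lᵢ ⁻¹))                    ≈⟨ -‿distribˡ-* _ _ ⟩
    coeff i                                  ∎
    where
    sN sᵢ LN Lᵢ : Carrier
    sN = sign N
    sᵢ = sign i
    LN = L N
    Lᵢ = L (N ℕ.+ i)

  R≤r^[N+i] : ∀ i → R ≤ r ^ (N ℕ.+ i)
  R≤r^[N+i] i = ℕP.^-monoʳ-≤ r (ℕP.m≤m+n N i)

  shiftedDen≈∑ : ∀ B j → j < B → shiftedDen j ≈ ∑[ i < B ] when (exponent i ≟ j) (coeff i)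
  shiftedDen≈∑ B j j<B = begin
    scale * denCoeff N (R ℕ.+ j)
      ≈⟨ *-congˡ (denCoeff≈∑ (R ℕ.+ j) B λ r^i≡R+j →
           r^i<r^N+B⇒i<N+B N B (≡.subst (_< R ℕ.+ B) (≡.sym r^i≡R+j) (ℕP.+-monoʳ-< R j<B))) ⟩
    scale * ∑[ i < B ] when (r ^ (N ℕ.+ i) ≟ R ℕ.+ j) (logTerm (N ℕ.+ i))
      ≈⟨ *-distribˡ-∑ B scale _ ⟩
    ∑[ i < B ] (scale * when (r ^ (N ℕ.+ i) ≟ R ℕ.+ j) (logTerm (N ℕ.+ i)))
      ≈⟨ ∑-cong B (λ i _ → trans (*-when (r ^ (N ℕ.+ i) ≟ R ℕ.+ j) scale _)
           (trans (when-cong (r ^ (N ℕ.+ i) ≟ R ℕ.+ j) (scale*logTerm i))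
                  (when-⇔ (r ^ (N ℕ.+ i) ≟ R ℕ.+ j) (exponent i ≟ j)
                    (λ eq → ≡.trans (≡.cong (_∸ R) eq) (ℕP.m+n∸m≡n R j))
                    (λ eq → ≡.trans (≡.sym (ℕP.m+[n∸m]≡n (R≤r^[N+i] i))) (≡.cong (R ℕ.+_) eq))))) ⟩
    ∑[ i < B ] when (exponent i ≟ j) (coeff i) ∎

  shiftedDen₀≈-1 : shiftedDen 0 ≈ - 1#
  shiftedDen₀≈-1 = begin
    shiftedDen 0                           ≈⟨ shiftedDen≈∑ 1 0 (s≤s z≤n) ⟩
    0# + when (exponent 0 ≟ 0) (coeff 0)   ≈⟨ +-identityˡ _ ⟩
    when (exponent 0 ≟ 0) (coeff 0)        ≈⟨ when-yes (exponent 0 ≟ 0) exponent₀≡0 ⟩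
    - L N * (1# * L (N ℕ.+ 0) ⁻¹)          ≈⟨ *-congˡ (*-identityˡ _) ⟩
    - L N * L (N ℕ.+ 0) ⁻¹                 ≡⟨ ≡.cong (λ n → - L N * L n ⁻¹) (ℕP.+-identityʳ N) ⟩
    - L N * L N ⁻¹                         ≈⟨ -‿distribˡ-* _ _ ⟨
    - (L N * L N ⁻¹)                       ≈⟨ -‿cong (⁻¹-inverse (L N) (L≉0 N)) ⟩
    - 1#                                   ∎
    where
    exponent₀≡0 : exponent 0 ≡ 0
    exponent₀≡0 = ≡.trans (≡.cong (λ n → r ^ n ∸ R) (ℕP.+-identityʳ N)) (ℕP.n∸n≡0 R)

  scale*numCoeff : ∀ n → scale * numCoeff N (R ℕ.+ n) ≈ - 1ˢ n
  scale*numCoeff zero = begin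
    scale * when (R ≟ R ℕ.+ 0) (sN * LN ⁻¹)   ≈⟨ *-congˡ (when-yes (R ≟ R ℕ.+ 0) (≡.sym (ℕP.+-identityʳ R))) ⟩
    - (sN * LN) * (sN * LN ⁻¹)                ≈⟨ -‿distribˡ-* _ _ ⟨
    - ((sN * LN) * (sN * LN ⁻¹))              ≈⟨ -‿cong (interchange sN LN sN (LN ⁻¹)) ⟩
    - ((sN * sN) * (LN * LN ⁻¹))              ≈⟨ -‿cong (*-cong (-1^n*-1^n≈1 N) (⁻¹-inverse LN (L≉0 N))) ⟩
    - (1# * 1#)                               ≈⟨ -‿cong (*-identityˡ 1#) ⟩
    - 1#                                      ∎
    where
    sN LN : Carrier
    sN = sign N
    LN = L N
  scale*numCoeff (suc n) = begin
    scale * when (R ≟ R ℕ.+ suc n) (sign N ÷ L N)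
      ≈⟨ *-congˡ (when-no (R ≟ R ℕ.+ suc n) (λ eq → ℕP.m≢1+m+n R (≡.trans eq (ℕP.+-suc R n)))) ⟩
    scale * 0#
      ≈⟨ zeroʳ scale ⟩
    0#
      ≈⟨ ε⁻¹≈ε ⟨
    - 0# ∎
    where open import Algebra.Properties.Group +-group using (ε⁻¹≈ε)

  shiftedDen*ˢ-quotient : ∀ (a : Series) → (∀ m → seriesMul (denCoeff N) a m ≈ numCoeff N m) →
                          ∀ n → (shiftedDen *ˢ a) n ≈ - 1ˢ n
  shiftedDen*ˢ-quotient a isQuotient n = begin
    ∑[ j < suc n ] ((scale * denCoeff N (R ℕ.+ j)) * a (n ∸ j))
      ≈⟨ ∑-cong (suc n) (λ j _ → *-assoc _ _ _) ⟩
    ∑[ j < suc n ] (scale * (denCoeff N (R ℕ.+ j) * a (n ∸ j)))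
      ≈⟨ *-distribˡ-∑ (suc n) scale _ ⟨
    scale * ((λ j → denCoeff N (R ℕ.+ j)) *ˢ a) n
      ≈⟨ *-congˡ (*ˢ-shiftˡ (denCoeff N) a R n denCoeff-below) ⟨
    scale * (denCoeff N *ˢ a) (R ℕ.+ n)
      ≈⟨ *-congˡ (∑<≈∑ (suc (R ℕ.+ n)) _) ⟨
    scale * seriesMul (denCoeff N) a (R ℕ.+ n)
      ≈⟨ *-congˡ (isQuotient (R ℕ.+ n)) ⟩
    scale * numCoeff N (R ℕ.+ n)
      ≈⟨ scale*numCoeff n ⟩
    - 1ˢ n ∎

  powerSum≡exponentSum+kR : ∀ {k} (v : Vec ℕ k) →
                            Vec.sum (Vec.map (λ i → r ^ (N ℕ.+ i)) v) ≡ exponentSum exponent v ℕ.+ k ℕ.* R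
  powerSum≡exponentSum+kR []      = ≡.refl
  powerSum≡exponentSum+kR (i ∷ v) = ≡.trans
    (≡.cong₂ ℕ._+_ (≡.sym (ℕP.m∸n+n≡m (R≤r^[N+i] i))) (powerSum≡exponentSum+kR v))
    (+-interchange (exponent i) R _ _)

  L-product≉0 : ∀ {k} (v : Vec ℕ k) → prodL (Vec.toList (Vec.map (λ i → L (N ℕ.+ i)) v)) ≉ 0#
  L-product≉0 []      = 1≉0
  L-product≉0 (i ∷ v) = *-≉0 (L≉0 (N ℕ.+ i)) (L-product≉0 v)

  -L^k*term≈coeffProduct : ∀ {k} (v : Vec ℕ k) →
    (- L N) ^ᴷ k * (sign (Vec.sum v) ÷ prodL (Vec.toList (Vec.map (λ i → L (N ℕ.+ i)) v))) ≈ coeffProduct coeff v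
  -L^k*term≈coeffProduct []      = trans (*-identityˡ _) (trans (*-identityˡ _) 1⁻¹≈1)
  -L^k*term≈coeffProduct {suc k} (i ∷ v) = begin
    (-LN * -LNᵏ) * (sign (i ℕ.+ Vec.sum v) * (Lᵢ * Lᵥ) ⁻¹)
      ≈⟨ *-congˡ (*-cong (^ᴷ-+ (- 1#) i (Vec.sum v)) (⁻¹-distrib-* (L≉0 (N ℕ.+ i)) (L-product≉0 v))) ⟩
    (-LN * -LNᵏ) * ((sign i * sign (Vec.sum v)) * (Lᵢ ⁻¹ * Lᵥ ⁻¹))
      ≈⟨ *-congˡ (interchange _ _ _ _) ⟩
    (-LN * -LNᵏ) * ((sign i * Lᵢ ⁻¹) * (sign (Vec.sum v) * Lᵥ ⁻¹))
      ≈⟨ interchange _ _ _ _ ⟩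
    coeff i * (-LNᵏ * (sign (Vec.sum v) * Lᵥ ⁻¹))
      ≈⟨ *-congˡ (-L^k*term≈coeffProduct v) ⟩
    coeff i * coeffProduct coeff v ∎
    where
    -LN -LNᵏ Lᵢ Lᵥ : Carrier
    -LN = - L N
    -LNᵏ = (- L N) ^ᴷ k
    Lᵢ = L (N ℕ.+ i)
    Lᵥ = prodL (Vec.toList (Vec.map (λ i → L (N ℕ.+ i)) v))

  -L^k*innerSum≈tupleSum : ∀ n k → (- L N) ^ᴷ k * innerSum N n k ≈ tupleSum exponent coeff (suc n) n k
  -L^k*innerSum≈tupleSum n k = trans (*-distribˡ-sumL (tuples (suc n) k) _ _)
    (sumL-map-cong (tuples (suc n) k) λ v →
      trans (*-when (powerSum v ≟ n ℕ.+ k ℕ.* R) _ _)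
     (trans (when-cong (powerSum v ≟ n ℕ.+ k ℕ.* R) (-L^k*term≈coeffProduct v))
            (when-⇔ (powerSum v ≟ n ℕ.+ k ℕ.* R) (exponentSum exponent v ≟ n)
              (λ eq → ℕP.+-cancelʳ-≡ (k ℕ.* R) _ _ (≡.trans (≡.sym (powerSum≡exponentSum+kR v)) eq))
              (λ eq → ≡.trans (powerSum≡exponentSum+kR v) (≡.cong (ℕ._+ k ℕ.* R) eq)))))
    where
    powerSum : Vec ℕ k → ℕ
    powerSum v = Vec.sum (Vec.map (λ i → r ^ (N ℕ.+ i)) v)

  quotient≈truncatedNegInverse : ∀ (a : Series) → (∀ m → seriesMul (denCoeff N) a m ≈ numCoeff N m) →
                                 ∀ n → a n ≈ truncatedNegInverse shiftedDen n n
  quotient≈truncatedNegInverse a isQuotient n =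
    *ˢ-cancelˡ-≤ {u = a} {v = truncatedNegInverse shiftedDen n} n -1*shiftedDen₀≈1
      (λ m m≤n → trans (shiftedDen*ˢ-quotient a isQuotient m)
                       (sym (*ˢ-truncatedNegInverse shiftedDen n shiftedDen₀≈-1 m m≤n)))
      n ℕP.≤-refl
    where
    open import Algebra.Properties.Ring ring using (-1*x≈-x)
    open import Algebra.Properties.Group +-group using (⁻¹-involutive)
    -1*shiftedDen₀≈1 : - 1# * shiftedDen 0 ≈ 1#
    -1*shiftedDen₀≈1 = trans (-1*x≈-x _) (trans (-‿cong shiftedDen₀≈-1) (⁻¹-involutive 1#))

  truncatedNegInverse≈rhsSum : ∀ n → truncatedNegInverse shiftedDen (suc n) (suc n) ≈
    ∑< (suc n) (λ j → fromℕ (suc (suc n) C suc (suc j)) * ((- L N) ^ᴷ suc j) * innerSum N (suc n) (suc j))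
  truncatedNegInverse≈rhsSum n = begin
    ∑[ k < suc (suc n) ] (binom (2+n) (suc k) * (shiftedDen ^ˢ k) (suc n))
      ≈⟨ ∑-head (suc n) _ ⟩
    binom (2+n) 1 * 0# + ∑[ k < suc n ] (binom (2+n) (suc (suc k)) * (shiftedDen ^ˢ suc k) (suc n))
      ≈⟨ trans (+-congʳ (zeroʳ _)) (+-identityˡ _) ⟩
    ∑[ k < suc n ] (binom (2+n) (suc (suc k)) * (shiftedDen ^ˢ suc k) (suc n))
      ≈⟨ ∑-cong (suc n) (λ k _ → term (suc k)) ⟩
    ∑[ k < suc n ] (fromℕ (2+n C suc (suc k)) * ((- L N) ^ᴷ suc k) * innerSum N (suc n) (suc k))
      ≈⟨ ∑<≈∑ (suc n) _ ⟨
    _ ∎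
    where
    2+n : ℕ
    2+n = suc (suc n)
    term : ∀ k → binom 2+n (suc k) * (shiftedDen ^ˢ k) (suc n)
                 ≈ fromℕ (2+n C suc k) * ((- L N) ^ᴷ k) * innerSum N (suc n) k
    term k = begin
      binom 2+n (suc k) * (shiftedDen ^ˢ k) (suc n)
        ≈⟨ *-cong (sym (fromℕ≈×1# (2+n C suc k))) (^ˢ-coeff≈tupleSum exponent coeff 2+n shiftedDen (suc n)
             (λ j j≤1+n → shiftedDen≈∑ 2+n j (s≤s j≤1+n)) k (suc n) ℕP.≤-refl) ⟩
      fromℕ (2+n C suc k) * tupleSum exponent coeff 2+n (suc n) k
        ≈⟨ *-congˡ (-L^k*innerSum≈tupleSum (suc n) k) ⟨
      fromℕ (2+n C suc k) * ((- L N) ^ᴷ k * innerSum N (suc n) k)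
        ≈⟨ *-assoc _ _ _ ⟨
      fromℕ (2+n C suc k) * ((- L N) ^ᴷ k) * innerSum N (suc n) k ∎

isPrimePower⇒1<r : ∀ {r} → IsPrimePower r → 1 < r
isPrimePower⇒1<r (p , e , p-prime , ≡.refl) =
  ℕP.≤-<-trans (s≤s z≤n) (PowersOf.n<r^n p (ℕ.nonTrivial⇒n>1 p {{prime⇒nonTrivial p-prime}}) (suc e))
  where open import Data.Nat.Primality using (prime⇒nonTrivial)

proposition2 : ∀ {c ℓ : Level} (K : Field c ℓ) (r : ℕ) (T : Field.Carrier K) →
    IsPrimePower r → IsRationalFunctionField K r T →
    ∀ (N : ℕ) → 1 ≤ N → (cc : ℕ → Field.Carrier K) →
    Carlitz.IsTruncCauchyCarlitz K r T N cc →
    ∀ (n : ℕ) → 1 ≤ n → Field._≈_ K (cc n) (Carlitz.rhs K r T N n)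
proposition2 K r T isPrimePower isRationalFunctionField N _ cc isTCC (suc n) _ = begin
  cc (suc n)
    ≈⟨ x≈y*[x÷y] (Π≉0 (suc n)) ⟩
  Π (suc n) * (cc (suc n) ÷ Π (suc n))
    ≈⟨ *-congˡ (quotient≈truncatedNegInverse (λ m → cc m ÷ Π m) isTCC (suc n)) ⟩
  Π (suc n) * truncatedNegInverse shiftedDen (suc n) (suc n)
    ≈⟨ *-congˡ (truncatedNegInverse≈rhsSum n) ⟩
  rhs N (suc n) ∎
  where
  open Field K
  open FieldOps K
  open Carlitz K r T
  open PowerSeries commutativeRing using (truncatedNegInverse)
  1<r : 1 < r
  1<r = isPrimePower⇒1<r isPrimePower
  open Nonvanishing K r T 1<r isRationalFunctionField
  open TruncatedCauchyCarlitz K r T 1<r L≉0 N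
  open import Relation.Binary.Reasoning.Setoid setoid
  open FieldFacts K using (x≈y*[x÷y])
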